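{- Let $\mathbf{o}\in\mathbb{R}^{\Upsilon}$ be an SE objective and let $m\in\mathbb{R}^{\Upsilon_c}$ satisfy $\mathbf{o}(a|B)=m(\{a\}\cup B)-m(B)$ for all $a\in N$, $B\subseteq N\setminus\{a\}$. Then for every $T\in\Upsilon_c$ and every $b\in T$, with $R=T\setminus\{b\}$, $$\sum_{\emptyset\neq K\subseteq R}(-1)^{|R\setminus K|}\,\mathbf{o}(b|K)=\sum_{L\in\Upsilon_c:\,L\subseteq T}(-1)^{|T\setminus L|}\,m(L).$$ In particular, the left-hand side does not depend on the choice of $b\in T$.
   Context: Let $N$ be a finite set with $n=|N|\ge 2$, and let $\mathrm{DAG}(N)$ be the set of acyclic directed graphs with node set $N$; $\mathrm{pa}_G(a)$ denotes the set of parents of $a$ in $G$. $G\sim H$ denotes Markov equivalence (same adjacencies and same immoralities). Let $\Upsilon=\{(a|B): a\in N,\ \emptyset\neq B\subseteq N\setminus\{a\}\}$ and $\Upsilon_c=\{S\subseteq N: |S|\ge 2\}$. For $G\in\mathrm{DAG}(N)$, $\eta_G\in\mathbb{R}^{\Upsilon}$ is given by $\eta_G(a|B)=1$ if $B=\mathrm{pa}_G(a)$ and $0$ otherwise. A vector $\mathbf{o}\in\mathbb{R}^{\Upsilon}$ is an SE objective if $\sum_{(a|B)}\mathbf{o}(a|B)\eta_G(a|B)=\sum_{(a|B)}\mathbf{o}(a|B)\eta_H(a|B)$ whenever $G\sim H$. Conventions: $\mathbf{o}(b|\emptyset)=0$ for $b\in N$, and $m(S)=0$ for $|S|\le 1$.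 -}

module Defs where

open import Level using (Level)
open import Data.Bool using (Bool; true; false)
open import Data.Nat using (ℕ; zero; suc; _≤_; _≤?_)
open import Data.Fin using (Fin)
open import Data.Fin.Subset using (Subset; _∈_; _∉_; _⊆_; _∪_; _─_; ⁅_⁆; ∣_∣; ⊥; Nonempty)
open import Data.Fin.Subset.Properties using (_⊆?_; nonempty?)
open import Data.Vec using (Vec; []; _∷_)
open import Data.List using (List; []; _∷_; map; _++_; foldr)
open import Data.Product using (_×_)
import Data.Product
open import Data.Sum using (_⊎_)
open import Relation.Nullary using (¬_; Dec; yes; no)
open import Relation.Binary.PropositionalEquality using (_≡_)
open import Relation.Binary.Construct.Closure.Transitive using (TransClosure)
open import Algebra.Bundles using (CommutativeRing)

-- Node set N = Fin n.  A directed graph on N is given by its parent-set function.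
Graph : ℕ → Set
Graph n = Fin n → Subset n

Edge : ∀ {n} → Graph n → Fin n → Fin n → Set
Edge pa b a = b ∈ pa a

Acyclic : ∀ {n} → Graph n → Set
Acyclic pa = ∀ a → ¬ TransClosure (Edge pa) a a

record DAG (n : ℕ) : Set where
  field
    pa      : Graph n
    acyclic : Acyclic pa
open DAG public

Adjacent : ∀ {n} → DAG n → Fin n → Fin n → Set
Adjacent G a b = a ∈ pa G b ⊎ b ∈ pa G a

Immorality : ∀ {n} → DAG n → Fin n → Fin n → Fin n → Set
Immorality G a c b = a ∈ pa G c × b ∈ pa G c × ¬ (a ≡ b) × ¬ Adjacent G a b

_⇔_ : Set → Set → Set
A ⇔ B = (A → B) × (B → A)

_∼_ : ∀ {n} → DAG n → DAG n → Set
G ∼ H = (∀ a b → Adjacent G a b ⇔ Adjacent H a b)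
      × (∀ a c b → Immorality G a c b ⇔ Immorality H a c b)

allSubsets : (n : ℕ) → List (Subset n)
allSubsets zero    = [] ∷ []
allSubsets (suc n) = map (false ∷_) (allSubsets n) ++ map (true ∷_) (allSubsets n)

allFins : (n : ℕ) → List (Fin n)
allFins zero    = []
allFins (suc n) = Fin.zero ∷ map Fin.suc (allFins n)

module Ring {c ℓ : Level} (R : CommutativeRing c ℓ) where
  open CommutativeRing R public

  sgn : ℕ → Carrier
  sgn zero    = 1#
  sgn (suc k) = - sgn k

  sumList : List Carrier → Carrier
  sumList = foldr _+_ 0#

  sumWhere : ∀ {n} {P : Subset n → Set} → ((S : Subset n) → Dec (P S))
           → (Subset n → Carrier) → Carrier
  sumWhere {n} P? f = sumList (map g (allSubsets n))
    where
      g : Subset _ → Carrier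
      g S with P? S
      ... | yes _ = f S
      ... | no  _ = 0#

  -- objectives o ∈ ℝ^Υ are represented as functions Fin n → Subset n → Carrier;
  -- only the values o(a|B) with a ∉ B, B ≠ ∅ are meaningful.
  -- convention o(b|∅) = 0:
  oext : ∀ {n} → (Fin n → Subset n → Carrier) → Fin n → Subset n → Carrier
  oext o a B with nonempty? B
  ... | yes _ = o a B
  ... | no  _ = 0#

  -- m ∈ ℝ^{Υ_c} is represented as Subset n → Carrier; convention m(S) = 0 for |S| ≤ 1:
  mext : ∀ {n} → (Subset n → Carrier) → Subset n → Carrier
  mext m S with 2 ≤? ∣ S ∣
  ... | yes _ = m S
  ... | no  _ = 0#

  -- ⟨o, η_G⟩ = Σ_{(a|B)∈Υ} o(a|B) η_G(a|B) = Σ_{a : pa_G(a) ≠ ∅} o(a | pa_G(a))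
  score : ∀ {n} → (Fin n → Subset n → Carrier) → DAG n → Carrier
  score {n} o G = sumList (map (λ a → oext o a (pa G a)) (allFins n))

  SEObjective : ∀ {n} → (Fin n → Subset n → Carrier) → Set ℓ
  SEObjective {n} o = ∀ (G H : DAG n) → G ∼ H → score o G ≈ score o H

  lhs : ∀ {n} → (Fin n → Subset n → Carrier) → Fin n → Subset n → Carrier
  lhs o b R = sumWhere (λ K → nonemptySub K) (λ K → sgn ∣ R ─ K ∣ * o b K)
    where
      nonemptySub : ∀ K → Dec (Nonempty K × K ⊆ R)
      nonemptySub K with nonempty? K | K ⊆? R
      ... | yes p | yes q = yes (p Data.Product., q)
      ... | no ¬p | _     = no (λ x → ¬p (Data.Product.proj₁ x))
      ... | yes _ | no ¬q = no (λ x → ¬q (Data.Product.proj₂ x))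

  rhs : ∀ {n} → (Subset n → Carrier) → Subset n → Carrier
  rhs m T = sumWhere (λ L → dec L) (λ L → sgn ∣ T ─ L ∣ * m L)
    where
      dec : ∀ L → Dec (2 ≤ ∣ L ∣ × L ⊆ T)
      dec L with 2 ≤? ∣ L ∣ | L ⊆? T
      ... | yes p | yes q = yes (p Data.Product., q)
      ... | no ¬p | _     = no (λ x → ¬p (Data.Product.proj₁ x))
      ... | yes _ | no ¬q = no (λ x → ¬q (Data.Product.proj₂ x))

-- Split the subsets L ⊆ T by whether they contain b: L = K or L = {b} ∪ K with K ⊆ T ∖ {b},
-- and the two members of a pair carry opposite signs. So the alternating sum of m over T is
-- the alternating sum over T ∖ {b} of the increments m({b} ∪ K) − m(K) = o(b|K), where the
-- term K = ∅ vanishes by the convention o(b|∅) = 0. Score equivalence is needed only for the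
-- existence of m.
module Submission where

open import Defs
open import Level using (Level)
open import Algebra.Bundles using (CommutativeRing)
import Algebra.Properties.CommutativeSemigroup as CommutativeSemigroupProperties
import Algebra.Properties.Ring as RingProperties
open import Data.Bool using (if_then_else_)
open import Data.Nat using (ℕ; _≤_; _≤?_; suc)
open import Data.Fin using (Fin; zero) renaming (suc to fsuc)
open import Data.Fin.Subset using (Subset; _∈_; _∉_; _⊆_; _∪_; _─_; ⁅_⁆; ∣_∣; ⊥; inside; outside)
open import Data.Fin.Subset.Properties
  using (_∈?_; _⊆?_; nonempty?; ∪-identityˡ; p─⊥≡p; p─q─r≡p─q∪r; p─q─r≡p─r─q; p─q⊆p;
         q⊆p∪q; x∈p∪q⁻; x∈⁅y⁆⇒x≡y; x∈p∧x∉q⇒x∈p─q; x∈p∧x≢y⇒x∈p-y)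
open import Data.List using (List; []; _∷_; map; _++_)
open import Data.List.Properties using (map-++; map-∘)
open import Data.Product using (_×_; _,_; proj₁; ∃)
open import Data.Sum using (inj₁; inj₂)
open import Data.Vec using (_∷_; here; there)
open import Function using (_∘_)
open import Relation.Nullary using (¬_; yes; no; does; contradiction)
open import Relation.Nullary.Decidable using (dec-true; dec-false)
open import Relation.Binary.PropositionalEquality as ≡ using (_≡_; cong)
import Relation.Binary.Reasoning.Setoid as SetoidReasoning

∣p∣≡1+∣p-x∣ : ∀ {n} {x : Fin n} {p : Subset n} → x ∈ p → ∣ p ∣ ≡ suc ∣ p ─ ⁅ x ⁆ ∣
∣p∣≡1+∣p-x∣ {p = inside ∷ p} here = cong suc (cong ∣_∣ (≡.sym (p─⊥≡p p)))
∣p∣≡1+∣p-x∣ {p = inside ∷ p} (there x∈p) = cong suc (∣p∣≡1+∣p-x∣ x∈p)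
∣p∣≡1+∣p-x∣ {p = outside ∷ p} (there x∈p) = ∣p∣≡1+∣p-x∣ x∈p

x∉p-x : ∀ {n} {x : Fin n} (p : Subset n) → x ∉ p ─ ⁅ x ⁆
x∉p-x {x = zero}   (s ∷ p) ()
x∉p-x {x = fsuc x} (s ∷ p) (there x∈p-x) = x∉p-x p x∈p-x

x∉p∧p⊆q⇒p⊆q-x : ∀ {n} {x : Fin n} {p q : Subset n} → x ∉ p → p ⊆ q → p ⊆ q ─ ⁅ x ⁆
x∉p∧p⊆q⇒p⊆q-x x∉p p⊆q y∈p = x∈p∧x≢y⇒x∈p-y (p⊆q y∈p) (λ { ≡.refl → x∉p y∈p })

x∈q∧p⊆q⇒⁅x⁆∪p⊆q : ∀ {n} {x : Fin n} {p q : Subset n} → x ∈ q → p ⊆ q → ⁅ x ⁆ ∪ p ⊆ q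
x∈q∧p⊆q⇒⁅x⁆∪p⊆q {x = x} {p} x∈q p⊆q y∈x∪p with x∈p∪q⁻ ⁅ x ⁆ p y∈x∪p
... | inj₁ y∈⁅x⁆ rewrite x∈⁅y⁆⇒x≡y x y∈⁅x⁆ = x∈q
... | inj₂ y∈p = p⊆q y∈p

∣q─p∣≡1+∣q-x─p∣ : ∀ {n} {x : Fin n} {p q : Subset n} → x ∈ q → x ∉ p →
                   ∣ q ─ p ∣ ≡ suc ∣ q ─ ⁅ x ⁆ ─ p ∣
∣q─p∣≡1+∣q-x─p∣ {x = x} {p} {q} x∈q x∉p = ≡.trans
  (∣p∣≡1+∣p-x∣ (x∈p∧x∉q⇒x∈p─q x∈q x∉p))
  (cong (λ r → suc ∣ r ∣) (p─q─r≡p─r─q q p ⁅ x ⁆))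

module AlternatingSums {c ℓ : Level} (CR : CommutativeRing c ℓ) where
  open Ring CR hiding (zero)
  open RingProperties ring using (-‿distribˡ-*; x[y-z]≈xy-xz)
  open SetoidReasoning setoid
  open CommutativeSemigroupProperties +-commutativeSemigroup
    using () renaming (interchange to +-interchange)

  ∑ : ∀ {n} → (Subset n → Carrier) → Carrier
  ∑ {n} f = sumList (map f (allSubsets n))

  ∑⊆ : ∀ {n} → Subset n → (Subset n → Carrier) → Carrier
  ∑⊆ A f = ∑ λ K → if does (K ⊆? A) then f K else 0#

  infix 5 ∑⊆
  syntax ∑⊆ A (λ K → e) = ∑[ K ⊆ A ] e

  sumList-++ : (xs ys : List Carrier) → sumList (xs ++ ys) ≈ sumList xs + sumList ys
  sumList-++ []       ys = sym (+-identityˡ _)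
  sumList-++ (x ∷ xs) ys = trans (+-congˡ (sumList-++ xs ys)) (sym (+-assoc x _ _))

  sumList-map-cong : ∀ {A : Set} {f g : A → Carrier} (xs : List A) →
                     (∀ x → f x ≈ g x) → sumList (map f xs) ≈ sumList (map g xs)
  sumList-map-cong []       f≈g = refl
  sumList-map-cong (x ∷ xs) f≈g = +-cong (f≈g x) (sumList-map-cong xs f≈g)

  ∑-cong : ∀ {n} {f g : Subset n → Carrier} → (∀ K → f K ≈ g K) → ∑ f ≈ ∑ g
  ∑-cong = sumList-map-cong (allSubsets _)

  ∑-+ : ∀ {n} (f g : Subset n → Carrier) → ∑ (λ K → f K + g K) ≈ ∑ f + ∑ g
  ∑-+ {n} f g = go (allSubsets n)
    where
    go : (xs : List (Subset n)) →
         sumList (map (λ K → f K + g K) xs) ≈ sumList (map f xs) + sumList (map g xs)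
    go []       = sym (+-identityˡ 0#)
    go (x ∷ xs) = trans (+-congˡ (go xs)) (+-interchange (f x) (g x) _ _)

  ∑-zero : ∀ {n} → ∑ {n} (λ _ → 0#) ≈ 0#
  ∑-zero {n} = go (allSubsets n)
    where
    go : (xs : List (Subset n)) → sumList (map (λ _ → 0#) xs) ≈ 0#
    go []       = refl
    go (x ∷ xs) = trans (+-congˡ (go xs)) (+-identityˡ 0#)

  ∑-suc : ∀ {n} (f : Subset (suc n) → Carrier) →
          ∑ f ≈ ∑ (λ K → f (outside ∷ K)) + ∑ (λ K → f (inside ∷ K))
  ∑-suc {n} f = begin
    sumList (map f (map (outside ∷_) A ++ map (inside ∷_) A))
      ≡⟨ cong sumList (map-++ f (map (outside ∷_) A) (map (inside ∷_) A)) ⟩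
    sumList (map f (map (outside ∷_) A) ++ map f (map (inside ∷_) A))
      ≈⟨ sumList-++ (map f (map (outside ∷_) A)) (map f (map (inside ∷_) A)) ⟩
    sumList (map f (map (outside ∷_) A)) + sumList (map f (map (inside ∷_) A))
      ≡⟨ ≡.cong₂ (λ u v → sumList u + sumList v) (≡.sym (map-∘ A)) (≡.sym (map-∘ A)) ⟩
    ∑ (λ K → f (outside ∷ K)) + ∑ (λ K → f (inside ∷ K)) ∎
    where A = allSubsets n

  ∑-pair : ∀ {n} (b : Fin n) (f : Subset n → Carrier) →
           ∑ f ≈ ∑ λ K → if does (b ∈? K) then 0# else f K + f (⁅ b ⁆ ∪ K)
  ∑-pair {suc n} zero f = begin
    ∑ f
      ≈⟨ ∑-suc f ⟩
    ∑ (λ K → f (outside ∷ K)) + ∑ (λ K → f (inside ∷ K))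
      ≈⟨ ∑-+ {n} _ _ ⟨
    ∑ (λ K → f (outside ∷ K) + f (inside ∷ K))
      ≈⟨ ∑-cong {n} (λ K → +-congˡ (reflexive (cong (f ∘ (inside ∷_)) (≡.sym (∪-identityˡ K))))) ⟩
    ∑ (λ K → f (outside ∷ K) + f (inside ∷ (⊥ ∪ K)))
      ≈⟨ +-identityʳ _ ⟨
    ∑ (λ K → f (outside ∷ K) + f (inside ∷ (⊥ ∪ K))) + 0#
      ≈⟨ +-congˡ (∑-zero {n}) ⟨
    ∑ (λ K → f (outside ∷ K) + f (inside ∷ (⊥ ∪ K))) + ∑ {n} (λ _ → 0#)
      ≈⟨ ∑-suc {n} _ ⟨
    (∑ λ K → if does (zero ∈? K) then 0# else f K + f (⁅ zero ⁆ ∪ K)) ∎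
  ∑-pair {suc n} (fsuc b) f = begin
    ∑ f
      ≈⟨ ∑-suc f ⟩
    ∑ (λ K → f (outside ∷ K)) + ∑ (λ K → f (inside ∷ K))
      ≈⟨ +-cong (∑-pair b (λ K → f (outside ∷ K))) (∑-pair b (λ K → f (inside ∷ K))) ⟩
    _
      ≈⟨ ∑-suc {n} _ ⟨
    (∑ λ K → if does (fsuc b ∈? K) then 0# else f K + f (⁅ fsuc b ⁆ ∪ K)) ∎

  ∑⊆-cong : ∀ {n} {A : Subset n} {f g : Subset n → Carrier} →
            (∀ K → K ⊆ A → f K ≈ g K) → ∑⊆ A f ≈ ∑⊆ A g
  ∑⊆-cong {n} {A} {f} {g} f≈g = ∑-cong {n} pointwise
    where
    pointwise : ∀ K → (if does (K ⊆? A) then f K else 0#) ≈ (if does (K ⊆? A) then g K else 0#)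
    pointwise K with K ⊆? A
    ... | yes K⊆A = f≈g K K⊆A
    ... | no  _   = refl

  -- lhs and rhs sum functions local to a where block of Defs; the first component names such a
  -- function by unification, so that it can be evaluated by with on the decisions it inspects.
  lhs-summand : ∀ {n} (o : Fin n → Subset n → Carrier) (b : Fin n) (A : Subset n) →
                ∃ λ (g : Subset n → Carrier) → lhs o b A ≡ ∑ g
  lhs-summand o b A = _ , ≡.refl

  rhs-summand : ∀ {n} (m : Subset n → Carrier) (T : Subset n) →
                ∃ λ (g : Subset n → Carrier) → rhs m T ≡ ∑ g
  rhs-summand m T = _ , ≡.refl

  lhs-as-∑⊆ : ∀ {n} (o : Fin n → Subset n → Carrier) (b : Fin n) (A : Subset n) →
              lhs o b A ≈ ∑[ K ⊆ A ] sgn ∣ A ─ K ∣ * oext o b K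
  lhs-as-∑⊆ {n} o b A = ∑-cong {n} pointwise
    where
    pointwise : ∀ K → proj₁ (lhs-summand o b A) K ≈
                      (if does (K ⊆? A) then sgn ∣ A ─ K ∣ * oext o b K else 0#)
    pointwise K with nonempty? K | K ⊆? A
    ... | yes _ | yes _ = refl
    ... | yes _ | no  _ = refl
    ... | no  _ | yes _ = sym (zeroʳ _)
    ... | no  _ | no  _ = refl

  rhs-as-∑⊆ : ∀ {n} (m : Subset n → Carrier) (T : Subset n) →
              rhs m T ≈ ∑[ L ⊆ T ] sgn ∣ T ─ L ∣ * mext m L
  rhs-as-∑⊆ {n} m T = ∑-cong {n} pointwise
    where
    pointwise : ∀ L → proj₁ (rhs-summand m T) L ≈
                      (if does (L ⊆? T) then sgn ∣ T ─ L ∣ * mext m L else 0#)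
    pointwise L with 2 ≤? ∣ L ∣ | L ⊆? T
    ... | yes _ | yes _ = refl
    ... | yes _ | no  _ = refl
    ... | no  _ | yes _ = sym (zeroʳ _)
    ... | no  _ | no  _ = refl

  alternating-∑⊆-peel : ∀ {n} {b : Fin n} {T : Subset n} (φ : Subset n → Carrier) → b ∈ T →
            (∑[ L ⊆ T ] sgn ∣ T ─ L ∣ * φ L) ≈
            (∑[ K ⊆ T ─ ⁅ b ⁆ ] sgn ∣ T ─ ⁅ b ⁆ ─ K ∣ * (φ (⁅ b ⁆ ∪ K) - φ K))
  alternating-∑⊆-peel {n} {b} {T} φ b∈T = trans (∑-pair b term) (∑-cong {n} paired)
    where
    term : Subset n → Carrier
    term L = if does (L ⊆? T) then sgn ∣ T ─ L ∣ * φ L else 0#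

    term-⊆ : ∀ {L} → L ⊆ T → term L ≡ sgn ∣ T ─ L ∣ * φ L
    term-⊆ {L} L⊆T = cong (if_then sgn ∣ T ─ L ∣ * φ L else 0#) (dec-true (L ⊆? T) L⊆T)

    term-⊈ : ∀ {L} → ¬ L ⊆ T → term L ≡ 0#
    term-⊈ {L} L⊈T = cong (if_then sgn ∣ T ─ L ∣ * φ L else 0#) (dec-false (L ⊆? T) L⊈T)

    paired : ∀ K → (if does (b ∈? K) then 0# else term K + term (⁅ b ⁆ ∪ K)) ≈
                   (if does (K ⊆? T ─ ⁅ b ⁆)
                    then sgn ∣ T ─ ⁅ b ⁆ ─ K ∣ * (φ (⁅ b ⁆ ∪ K) - φ K)
                    else 0#)
    paired K with b ∈? K | K ⊆? T ─ ⁅ b ⁆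
    ... | yes b∈K | yes K⊆R = contradiction (K⊆R b∈K) (x∉p-x T)
    ... | yes _   | no  _   = refl
    ... | no  b∉K | no  K⊈R = begin
      term K + term (⁅ b ⁆ ∪ K)  ≡⟨ ≡.cong₂ _+_ (term-⊈ K⊈T) (term-⊈ b∪K⊈T) ⟩
      0# + 0#                    ≈⟨ +-identityˡ 0# ⟩
      0#                         ∎
      where
      K⊈T : ¬ K ⊆ T
      K⊈T K⊆T = K⊈R (x∉p∧p⊆q⇒p⊆q-x b∉K K⊆T)
      b∪K⊈T : ¬ ⁅ b ⁆ ∪ K ⊆ T
      b∪K⊈T b∪K⊆T = K⊈T (b∪K⊆T ∘ q⊆p∪q ⁅ b ⁆ K)
    ... | no  b∉K | yes K⊆R = begin
      term K + term (⁅ b ⁆ ∪ K)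
        ≡⟨ ≡.cong₂ _+_ (term-⊆ K⊆T) (term-⊆ (x∈q∧p⊆q⇒⁅x⁆∪p⊆q b∈T K⊆T)) ⟩
      sgn ∣ T ─ K ∣ * φ K + sgn ∣ T ─ (⁅ b ⁆ ∪ K) ∣ * φ (⁅ b ⁆ ∪ K)
        ≡⟨ ≡.cong₂ (λ i j → sgn i * φ K + sgn j * φ (⁅ b ⁆ ∪ K))
                   (∣q─p∣≡1+∣q-x─p∣ b∈T b∉K) (cong ∣_∣ (≡.sym (p─q─r≡p─q∪r T ⁅ b ⁆ K))) ⟩
      - s * φ K + s * φ (⁅ b ⁆ ∪ K)
        ≈⟨ +-congʳ (-‿distribˡ-* s (φ K)) ⟨
      - (s * φ K) + s * φ (⁅ b ⁆ ∪ K)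
        ≈⟨ +-comm _ _ ⟩
      s * φ (⁅ b ⁆ ∪ K) - s * φ K
        ≈⟨ x[y-z]≈xy-xz s (φ (⁅ b ⁆ ∪ K)) (φ K) ⟨
      s * (φ (⁅ b ⁆ ∪ K) - φ K) ∎
      where
      s : Carrier
      s = sgn ∣ T ─ ⁅ b ⁆ ─ K ∣
      K⊆T : K ⊆ T
      K⊆T = p─q⊆p T ⁅ b ⁆ ∘ K⊆R

  module Increments {n : ℕ} (o : Fin n → Subset n → Carrier) (m : Subset n → Carrier)
    (o≈Δm : ∀ (a : Fin n) (B : Subset n) → a ∉ B → oext o a B ≈ mext m (⁅ a ⁆ ∪ B) - mext m B)
    where

    lhs≈rhs : ∀ {T : Subset n} {b : Fin n} → b ∈ T → lhs o b (T ─ ⁅ b ⁆) ≈ rhs m T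
    lhs≈rhs {T} {b} b∈T = begin
      lhs o b R
        ≈⟨ lhs-as-∑⊆ o b R ⟩
      (∑[ K ⊆ R ] sgn ∣ R ─ K ∣ * oext o b K)
        ≈⟨ ∑⊆-cong (λ K K⊆R → *-congˡ (o≈Δm b K (x∉p-x T ∘ K⊆R))) ⟩
      (∑[ K ⊆ R ] sgn ∣ R ─ K ∣ * (mext m (⁅ b ⁆ ∪ K) - mext m K))
        ≈⟨ alternating-∑⊆-peel (mext m) b∈T ⟨
      (∑[ L ⊆ T ] sgn ∣ T ─ L ∣ * mext m L)
        ≈⟨ rhs-as-∑⊆ m T ⟨
      rhs m T ∎
      where
      R : Subset n
      R = T ─ ⁅ b ⁆

corollary3 : ∀ {c ℓ} (R : CommutativeRing c ℓ) → let open Ring R in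
    (n : ℕ) → 2 ≤ n →
    (o : Fin n → Subset n → Carrier) → SEObjective o →
    (m : Subset n → Carrier) →
    (∀ (a : Fin n) (B : Subset n) → a ∉ B → oext o a B ≈ mext m (⁅ a ⁆ ∪ B) - mext m B) →
    (T : Subset n) → 2 ≤ ∣ T ∣ →
    ((b : Fin n) → b ∈ T → lhs o b (T ─ ⁅ b ⁆) ≈ rhs m T)
    × ((b b′ : Fin n) → b ∈ T → b′ ∈ T → lhs o b (T ─ ⁅ b ⁆) ≈ lhs o b′ (T ─ ⁅ b′ ⁆))
corollary3 R n _ o _ m o≈Δm T _ =
  (λ _ → lhs≈rhs) ,
  (λ _ _ b∈T b′∈T → Ring.trans R (lhs≈rhs b∈T) (Ring.sym R (lhs≈rhs b′∈T)))
  where open AlternatingSums.Increments R o m o≈Δm using (lhs≈rhs)
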